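{- Let $U\cong\Lambda$, $\Upsilon=\frac1{\sqrt2}U$, and let $M,N$ be a polarization of $\Upsilon$ with $M\cong N\cong\Lambda$. If $(w,x,y,z)$ is an offender, then the three vectors $x+w$, $y+w$, $z+w$ are pairwise orthogonal.
   Context: All lattices are positive definite rational lattices. The Leech lattice $\Lambda$ is the (unique up to isometry) even unimodular lattice of rank 24 with no vectors of norm 2. For $U$ even unimodular and $\Upsilon=\frac1{\sqrt2}U$, a polarization of $\Upsilon$ is a pair of integral sublattices $M,N\subseteq\Upsilon$ with $M+N=\Upsilon$ and $M\cap N=2\Upsilon$. An ordered 4-tuple $(w,x,y,z)\in N\times M\times M\times M$ is admissible if $x+y+z\in M\cap N$. An offender is an admissible 4-tuple such that each of $x+w,y+w,z+w$ has norm 2; these three vectors are called a triple of offender roots. -}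

module Defs where

open import Data.Nat using (ℕ; zero; suc)
open import Data.Fin using (Fin; zero; suc)
open import Data.Integer using (ℤ; _+_; _*_; -_; _<_; 0ℤ; 1ℤ)
open import Data.Integer.Divisibility using (_∣_)
open import Data.Product using (Σ; ∃; _×_; _,_)
open import Relation.Binary.PropositionalEquality using (_≡_; _≢_)
open import Relation.Nullary using (¬_)
open import Function.Bundles using (_⇔_)

Vecℤ : ℕ → Set
Vecℤ n = Fin n → ℤ

Matℤ : ℕ → Set
Matℤ n = Fin n → Fin n → ℤ

Σᶠ : ∀ {n} → (Fin n → ℤ) → ℤ
Σᶠ {zero}  f = 0ℤ
Σᶠ {suc n} f = f zero + Σᶠ (λ i → f (suc i))

bil : ∀ {n} → Matℤ n → Vecℤ n → Vecℤ n → ℤ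
bil G u v = Σᶠ (λ i → Σᶠ (λ j → u i * G i j * v j))

_·ᴹ_ : ∀ {n} → Matℤ n → Matℤ n → Matℤ n
(A ·ᴹ B) i k = Σᶠ (λ j → A i j * B j k)

δ : ∀ {n} → Fin n → Fin n → ℤ
δ zero    zero    = 1ℤ
δ zero    (suc _) = 0ℤ
δ (suc _) zero    = 0ℤ
δ (suc i) (suc j) = δ i j

_·ᵛ_ : ∀ {n} → Vecℤ n → Matℤ n → Vecℤ n
(c ·ᵛ B) j = Σᶠ (λ i → c i * B i j)

_+ᵛ_ : ∀ {n} → Vecℤ n → Vecℤ n → Vecℤ n
(u +ᵛ v) i = u i + v i

-ᵛ_ : ∀ {n} → Vecℤ n → Vecℤ n
(-ᵛ u) i = - u i

0ᵛ : ∀ {n} → Vecℤ n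
0ᵛ _ = 0ℤ

2ᵛ_ : ∀ {n} → Vecℤ n → Vecℤ n
(2ᵛ u) i = (Data.Integer.+ 2) * u i

-- A Gram matrix A (w.r.t. some basis of ℤ²⁴) of a Leech lattice:
-- symmetric, positive definite, even, unimodular (integrally invertible),
-- and without vectors of norm 2.  By the uniqueness of Λ, a lattice is
-- isometric to Λ iff it has such a Gram matrix.
record IsLeechGram (A : Matℤ 24) : Set where
  field
    symmetric : ∀ i j → A i j ≡ A j i
    posdef    : ∀ (c : Vecℤ 24) → ¬ (∀ i → c i ≡ 0ℤ) → 0ℤ < bil A c c
    even      : ∀ (c : Vecℤ 24) → (Data.Integer.+ 2) ∣ bil A c c
    unimod    : ∃ λ (H : Matℤ 24) → ∀ i k → (A ·ᴹ H) i k ≡ δ i k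
    noRoots   : ∀ (c : Vecℤ 24) → bil A c c ≢ Data.Integer.+ 2

-- Model: U ≅ Λ is ℤ²⁴ with form bil G, G a Leech Gram matrix.
-- Υ = (1/√2) U is the same group with form ⟪u,v⟫ = bil G u v / 2.
-- Subsets of Υ are predicates on Vecℤ 24.
Subset : Set₁
Subset = Vecℤ 24 → Set

record IsSublattice (M : Subset) : Set where
  field
    has0   : M 0ᵛ
    closed+ : ∀ {u v} → M u → M v → M (u +ᵛ v)
    closed- : ∀ {u} → M u → M (-ᵛ u)

-- Integral w.r.t. the Υ-form:  ⟪u,v⟫ = bil G u v / 2 ∈ ℤ.
Integral : Matℤ 24 → Subset → Set
Integral G M = ∀ {u v} → M u → M v → (Data.Integer.+ 2) ∣ bil G u v

-- M (with the Υ-form) is isometric to Λ: M = ℤ-span of the rows of B,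
-- and the Υ-Gram matrix (B G Bᵀ)/2 of these rows is a Leech Gram matrix.
IsoLeech : Matℤ 24 → Subset → Set
IsoLeech G M =
  Σ (Matℤ 24) λ B → Σ (Matℤ 24) λ A →
    IsLeechGram A
    × (∀ i j → bil G (B i) (B j) ≡ (Data.Integer.+ 2) * A i j)
    × (∀ (v : Vecℤ 24) → M v ⇔ (∃ λ (c : Vecℤ 24) → ∀ k → v k ≡ (c ·ᵛ B) k))

record Polarization (G : Matℤ 24) (M N : Subset) : Set where
  field
    subM   : IsSublattice M
    subN   : IsSublattice N
    intM   : Integral G M
    intN   : Integral G N
    sum    : ∀ (v : Vecℤ 24) → ∃ λ (m : Vecℤ 24) → ∃ λ (n : Vecℤ 24) → M m × N n × (∀ k → v k ≡ (m +ᵛ n) k)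
    inter  : ∀ (v : Vecℤ 24) → (M v × N v) ⇔ (∃ λ (u : Vecℤ 24) → ∀ k → v k ≡ (2ᵛ u) k)

-- Υ-norm equal to 2 means bil G v v = 4.
ΥNorm2 : Matℤ 24 → Vecℤ 24 → Set
ΥNorm2 G v = bil G v v ≡ Data.Integer.+ 4

record Offender (G : Matℤ 24) (M N : Subset) (w x y z : Vecℤ 24) : Set where
  field
    w∈N : N w
    x∈M : M x
    y∈M : M y
    z∈M : M z
    admissible : M ((x +ᵛ y) +ᵛ z) × N ((x +ᵛ y) +ᵛ z)
    normxw : ΥNorm2 G (x +ᵛ w)
    normyw : ΥNorm2 G (y +ᵛ w)
    normzw : ΥNorm2 G (z +ᵛ w)

{-# OPTIONS --safe #-}
-- Put a = x + w and b = y + w, two roots of Υ, and t = ⟨a, b⟩.  Both a − b = x − y and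
-- a + b = x + y + 2w lie in M ≅ Λ and have norms 4 ∓ 2t; since Λ has no roots each of these
-- is 0 or at least 4, so t = 0 unless a = b or a = −b.  In either exceptional case
-- admissibility forces z ∈ 2Υ ⊆ N, and then z + w ∈ N ≅ Λ would be a root.
module Submission where

open import Defs
open import Data.Integer using (0ℤ)
open import Data.Product using (_×_)
open import Relation.Binary.PropositionalEquality using (_≡_)

open import Data.Empty using (⊥-elim)
open import Data.Fin using (Fin; zero; suc)
open import Data.Fin.Properties using (all?)
open import Data.Integer using (ℤ; _+_; _-_; _*_; -_; _<_; _≤_; +_; +<+; +≤+; _≟_)
open import Data.Integer.Divisibility using (_∣_)
open import Data.Integer.Properties
open import Algebra.Properties.CommutativeSemigroup +-commutativeSemigroup
  using (xy∙z≈xz∙y; xy∙z≈zx∙y) renaming (interchange to +-interchange)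
open import Data.Integer.Tactic.RingSolver using (solve-∀)
open import Data.Nat using (ℕ; zero; suc; s≤s; z≤n)
open import Data.Nat.Divisibility using (divides)
open import Data.Product using (∃; _,_; proj₁; proj₂)
open import Data.Sum as Sum using (_⊎_; inj₁; inj₂)
open import Function using (_∘_)
open import Function.Bundles using (Equivalence)
open import Relation.Binary.PropositionalEquality
  using (_≢_; _≗_; refl; sym; trans; cong; cong₂; subst; module ≡-Reasoning)
open import Relation.Nullary using (¬_; yes; no)

open ≡-Reasoning

Σᶠ-cong : ∀ {n} {f g : Fin n → ℤ} → f ≗ g → Σᶠ f ≡ Σᶠ g
Σᶠ-cong {zero}  f≗g = refl
Σᶠ-cong {suc n} f≗g = cong₂ _+_ (f≗g zero) (Σᶠ-cong (f≗g ∘ suc))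

Σᶠ-zero : ∀ n → Σᶠ {n} (λ _ → 0ℤ) ≡ 0ℤ
Σᶠ-zero zero    = refl
Σᶠ-zero (suc n) = trans (+-identityˡ _) (Σᶠ-zero n)

Σᶠ-distrib-+ : ∀ {n} (f g : Fin n → ℤ) → Σᶠ (λ i → f i + g i) ≡ Σᶠ f + Σᶠ g
Σᶠ-distrib-+ {zero}  f g = refl
Σᶠ-distrib-+ {suc n} f g = begin
  f zero + g zero + Σᶠ (λ i → f (suc i) + g (suc i))
    ≡⟨ cong (λ s → f zero + g zero + s) (Σᶠ-distrib-+ (λ i → f (suc i)) (λ i → g (suc i))) ⟩
  f zero + g zero + (Σᶠ (λ i → f (suc i)) + Σᶠ (λ i → g (suc i)))
    ≡⟨ +-interchange (f zero) (g zero) _ _ ⟩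
  Σᶠ f + Σᶠ g ∎

neg-distrib-Σᶠ : ∀ {n} (f : Fin n → ℤ) → Σᶠ (λ i → - f i) ≡ - Σᶠ f
neg-distrib-Σᶠ {zero}  f = refl
neg-distrib-Σᶠ {suc n} f = trans (cong (λ s → - f zero + s) (neg-distrib-Σᶠ (λ i → f (suc i))))
                                 (sym (neg-distrib-+ (f zero) _))

*-distribˡ-Σᶠ : ∀ {n} a (f : Fin n → ℤ) → Σᶠ (λ i → a * f i) ≡ a * Σᶠ f
*-distribˡ-Σᶠ {zero}  a f = sym (*-zeroʳ a)
*-distribˡ-Σᶠ {suc n} a f = trans (cong (λ s → a * f zero + s) (*-distribˡ-Σᶠ a (λ i → f (suc i))))
                                  (sym (*-distribˡ-+ a (f zero) _))

*-distribʳ-Σᶠ : ∀ {n} a (f : Fin n → ℤ) → Σᶠ (λ i → f i * a) ≡ Σᶠ f * a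
*-distribʳ-Σᶠ a f = begin
  Σᶠ (λ i → f i * a) ≡⟨ Σᶠ-cong (λ i → *-comm (f i) a) ⟩
  Σᶠ (λ i → a * f i) ≡⟨ *-distribˡ-Σᶠ a f ⟩
  a * Σᶠ f           ≡⟨ *-comm a _ ⟩
  Σᶠ f * a           ∎

Σᶠ-comm : ∀ {m n} (f : Fin m → Fin n → ℤ) →
          Σᶠ (λ i → Σᶠ (λ j → f i j)) ≡ Σᶠ (λ j → Σᶠ (λ i → f i j))
Σᶠ-comm {zero}  {n} f = sym (Σᶠ-zero n)
Σᶠ-comm {suc m} f = trans (cong (λ s → Σᶠ (f zero) + s) (Σᶠ-comm (λ i → f (suc i))))
                          (sym (Σᶠ-distrib-+ (f zero) _))

_ᵀ : ∀ {n} → Matℤ n → Matℤ n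
(G ᵀ) i j = G j i

Gram : ∀ {n} → Matℤ n → Matℤ n → Matℤ n
Gram G B i j = bil G (B i) (B j)

module _ {n : ℕ} where

  bil-cong : (G : Matℤ n) {u u′ v v′ : Vecℤ n} → u ≗ u′ → v ≗ v′ → bil G u v ≡ bil G u′ v′
  bil-cong G u≗u′ v≗v′ = Σᶠ-cong λ i → Σᶠ-cong λ j → cong₂ (λ a b → a * G i j * b) (u≗u′ i) (v≗v′ j)

  bil-congᴹ : {G G′ : Matℤ n} → (∀ i j → G i j ≡ G′ i j) → ∀ u v → bil G u v ≡ bil G′ u v
  bil-congᴹ G≡G′ u v = Σᶠ-cong λ i → Σᶠ-cong λ j → cong (λ g → u i * g * v j) (G≡G′ i j)

  bil-transpose : (G : Matℤ n) (u v : Vecℤ n) → bil G u v ≡ bil (G ᵀ) v u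
  bil-transpose G u v = trans (Σᶠ-comm {n} {n} _) (Σᶠ-cong λ j → Σᶠ-cong λ i → flip (u i) (G i j) (v j))
    where
    flip : ∀ a g b → a * g * b ≡ b * g * a
    flip = solve-∀

  bil-sym : (G : Matℤ n) → (∀ i j → G i j ≡ G j i) → ∀ u v → bil G u v ≡ bil G v u
  bil-sym G G-sym u v = trans (bil-transpose G u v) (bil-congᴹ (λ i j → G-sym j i) v u)

  bil-zeroˡ : (G : Matℤ n) (v : Vecℤ n) → bil G 0ᵛ v ≡ 0ℤ
  bil-zeroˡ G v = trans (Σᶠ-cong {n} λ i → Σᶠ-zero n) (Σᶠ-zero n)

  bil-+ˡ : (G : Matℤ n) (u u′ v : Vecℤ n) → bil G (u +ᵛ u′) v ≡ bil G u v + bil G u′ v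
  bil-+ˡ G u u′ v = begin
    bil G (u +ᵛ u′) v
      ≡⟨ Σᶠ-cong (λ i → Σᶠ-cong λ j → distrib (u i) (u′ i) (G i j) (v j)) ⟩
    Σᶠ (λ i → Σᶠ (λ j → u i * G i j * v j + u′ i * G i j * v j))
      ≡⟨ Σᶠ-cong {n} (λ i → Σᶠ-distrib-+ {n} _ _) ⟩
    Σᶠ (λ i → Σᶠ (λ j → u i * G i j * v j) + Σᶠ (λ j → u′ i * G i j * v j))
      ≡⟨ Σᶠ-distrib-+ {n} _ _ ⟩
    bil G u v + bil G u′ v ∎
    where
    distrib : ∀ a a′ g b → (a + a′) * g * b ≡ a * g * b + a′ * g * b
    distrib = solve-∀

  bil-+ʳ : (G : Matℤ n) (u v v′ : Vecℤ n) → bil G u (v +ᵛ v′) ≡ bil G u v + bil G u v′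
  bil-+ʳ G u v v′ = begin
    bil G u (v +ᵛ v′)                   ≡⟨ bil-transpose G u (v +ᵛ v′) ⟩
    bil (G ᵀ) (v +ᵛ v′) u               ≡⟨ bil-+ˡ (G ᵀ) v v′ u ⟩
    bil (G ᵀ) v u + bil (G ᵀ) v′ u      ≡⟨ sym (cong₂ _+_ (bil-transpose G u v) (bil-transpose G u v′)) ⟩
    bil G u v + bil G u v′              ∎

  bil-negˡ : (G : Matℤ n) (u v : Vecℤ n) → bil G (-ᵛ u) v ≡ - bil G u v
  bil-negˡ G u v = begin
    bil G (-ᵛ u) v
      ≡⟨ Σᶠ-cong (λ i → Σᶠ-cong λ j → pull (u i) (G i j) (v j)) ⟩
    Σᶠ (λ i → Σᶠ (λ j → - (u i * G i j * v j)))
      ≡⟨ Σᶠ-cong {n} (λ i → neg-distrib-Σᶠ {n} _) ⟩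
    Σᶠ (λ i → - Σᶠ (λ j → u i * G i j * v j))
      ≡⟨ neg-distrib-Σᶠ {n} _ ⟩
    - bil G u v ∎
    where
    pull : ∀ a g b → - a * g * b ≡ - (a * g * b)
    pull = solve-∀

  bil-negʳ : (G : Matℤ n) (u v : Vecℤ n) → bil G u (-ᵛ v) ≡ - bil G u v
  bil-negʳ G u v = begin
    bil G u (-ᵛ v)        ≡⟨ bil-transpose G u (-ᵛ v) ⟩
    bil (G ᵀ) (-ᵛ v) u    ≡⟨ bil-negˡ (G ᵀ) v u ⟩
    - bil (G ᵀ) v u       ≡⟨ cong -_ (sym (bil-transpose G u v)) ⟩
    - bil G u v           ∎

  bil-*ᴹ : (k : ℤ) (G : Matℤ n) (u v : Vecℤ n) → bil (λ i j → k * G i j) u v ≡ k * bil G u v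
  bil-*ᴹ k G u v = begin
    bil (λ i j → k * G i j) u v
      ≡⟨ Σᶠ-cong (λ i → Σᶠ-cong λ j → pull k (u i) (G i j) (v j)) ⟩
    Σᶠ (λ i → Σᶠ (λ j → k * (u i * G i j * v j)))
      ≡⟨ Σᶠ-cong {n} (λ i → *-distribˡ-Σᶠ {n} k _) ⟩
    Σᶠ (λ i → k * Σᶠ (λ j → u i * G i j * v j))
      ≡⟨ *-distribˡ-Σᶠ {n} k _ ⟩
    k * bil G u v ∎
    where
    pull : ∀ k a g b → a * (k * g) * b ≡ k * (a * g * b)
    pull = solve-∀

  bil-·ᵛˡ : (G : Matℤ n) (c : Vecℤ n) (B : Matℤ n) (v : Vecℤ n) →
            bil G (c ·ᵛ B) v ≡ Σᶠ (λ i → c i * bil G (B i) v)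
  bil-·ᵛˡ G c B v = begin
    Σᶠ (λ k → Σᶠ (λ l → (c ·ᵛ B) k * G k l * v l))
      ≡⟨ Σᶠ-cong {n} (λ k → Σᶠ-cong {n} λ l → expand k l) ⟩
    Σᶠ (λ k → Σᶠ (λ l → Σᶠ (λ i → c i * (B i k * G k l * v l))))
      ≡⟨ Σᶠ-cong {n} (λ k → Σᶠ-comm {n} {n} _) ⟩
    Σᶠ (λ k → Σᶠ (λ i → Σᶠ (λ l → c i * (B i k * G k l * v l))))
      ≡⟨ Σᶠ-comm {n} {n} _ ⟩
    Σᶠ (λ i → Σᶠ (λ k → Σᶠ (λ l → c i * (B i k * G k l * v l))))
      ≡⟨ Σᶠ-cong {n} (λ i → trans (Σᶠ-cong {n} λ k → *-distribˡ-Σᶠ {n} (c i) _)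
                                   (*-distribˡ-Σᶠ {n} (c i) _)) ⟩
    Σᶠ (λ i → c i * bil G (B i) v) ∎
    where
    reassoc : ∀ a b g x → a * b * g * x ≡ a * (b * g * x)
    reassoc = solve-∀
    expand : ∀ k l → (c ·ᵛ B) k * G k l * v l ≡ Σᶠ (λ i → c i * (B i k * G k l * v l))
    expand k l = begin
      Σᶠ (λ i → c i * B i k) * G k l * v l
        ≡⟨ cong (_* v l) (sym (*-distribʳ-Σᶠ {n} (G k l) _)) ⟩
      Σᶠ (λ i → c i * B i k * G k l) * v l
        ≡⟨ sym (*-distribʳ-Σᶠ {n} (v l) _) ⟩
      Σᶠ (λ i → c i * B i k * G k l * v l)
        ≡⟨ Σᶠ-cong {n} (λ i → reassoc (c i) (B i k) (G k l) (v l)) ⟩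
      Σᶠ (λ i → c i * (B i k * G k l * v l)) ∎

  bil-·ᵛʳ : (G : Matℤ n) (u d : Vecℤ n) (B : Matℤ n) →
            bil G u (d ·ᵛ B) ≡ Σᶠ (λ j → d j * bil G u (B j))
  bil-·ᵛʳ G u d B = begin
    bil G u (d ·ᵛ B)                        ≡⟨ bil-transpose G u (d ·ᵛ B) ⟩
    bil (G ᵀ) (d ·ᵛ B) u                    ≡⟨ bil-·ᵛˡ (G ᵀ) d B u ⟩
    Σᶠ (λ j → d j * bil (G ᵀ) (B j) u)      ≡⟨ Σᶠ-cong {n} (λ j → cong (d j *_) (sym (bil-transpose G u (B j)))) ⟩
    Σᶠ (λ j → d j * bil G u (B j))          ∎

  bil-·ᵛ : (G B : Matℤ n) (c d : Vecℤ n) → bil G (c ·ᵛ B) (d ·ᵛ B) ≡ bil (Gram G B) c d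
  bil-·ᵛ G B c d = begin
    bil G (c ·ᵛ B) (d ·ᵛ B)
      ≡⟨ bil-·ᵛˡ G c B (d ·ᵛ B) ⟩
    Σᶠ (λ i → c i * bil G (B i) (d ·ᵛ B))
      ≡⟨ Σᶠ-cong {n} (λ i → cong (c i *_) (bil-·ᵛʳ G (B i) d B)) ⟩
    Σᶠ (λ i → c i * Σᶠ (λ j → d j * Gram G B i j))
      ≡⟨ Σᶠ-cong {n} (λ i → sym (*-distribˡ-Σᶠ {n} (c i) _)) ⟩
    Σᶠ (λ i → Σᶠ (λ j → c i * (d j * Gram G B i j)))
      ≡⟨ Σᶠ-cong {n} (λ i → Σᶠ-cong {n} λ j → reorder (c i) (d j) (Gram G B i j)) ⟩
    bil (Gram G B) c d ∎
    where
    reorder : ∀ a b g → a * (b * g) ≡ a * g * b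
    reorder = solve-∀

  module _ (G : Matℤ n) (G-sym : ∀ i j → G i j ≡ G j i) (u v : Vecℤ n) where

    bil-norm-sum : bil G (u +ᵛ v) (u +ᵛ v) ≡ bil G u u + + 2 * bil G u v + bil G v v
    bil-norm-sum = begin
      bil G (u +ᵛ v) (u +ᵛ v)
        ≡⟨ bil-+ˡ G u v (u +ᵛ v) ⟩
      bil G u (u +ᵛ v) + bil G v (u +ᵛ v)
        ≡⟨ cong₂ _+_ (bil-+ʳ G u u v) (bil-+ʳ G v u v) ⟩
      (bil G u u + bil G u v) + (bil G v u + bil G v v)
        ≡⟨ cong (λ t → (bil G u u + bil G u v) + (t + bil G v v)) (bil-sym G G-sym v u) ⟩
      (bil G u u + bil G u v) + (bil G u v + bil G v v)
        ≡⟨ collect (bil G u u) (bil G u v) (bil G v v) ⟩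
      bil G u u + + 2 * bil G u v + bil G v v ∎
      where
      collect : ∀ a b c → (a + b) + (b + c) ≡ a + + 2 * b + c
      collect = solve-∀

    bil-norm-difference : bil G (u +ᵛ (-ᵛ v)) (u +ᵛ (-ᵛ v)) ≡ bil G u u - + 2 * bil G u v + bil G v v
    bil-norm-difference = begin
      bil G (u +ᵛ (-ᵛ v)) (u +ᵛ (-ᵛ v))
        ≡⟨ bil-+ˡ G u (-ᵛ v) (u +ᵛ (-ᵛ v)) ⟩
      bil G u (u +ᵛ (-ᵛ v)) + bil G (-ᵛ v) (u +ᵛ (-ᵛ v))
        ≡⟨ cong₂ _+_ (bil-+ʳ G u u (-ᵛ v)) (bil-negˡ G v (u +ᵛ (-ᵛ v))) ⟩
      (bil G u u + bil G u (-ᵛ v)) - bil G v (u +ᵛ (-ᵛ v))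
        ≡⟨ cong₂ (λ s t → (bil G u u + s) - t) (bil-negʳ G u v) (bil-+ʳ G v u (-ᵛ v)) ⟩
      (bil G u u - bil G u v) - (bil G v u + bil G v (-ᵛ v))
        ≡⟨ cong₂ (λ s t → (bil G u u - bil G u v) - (s + t)) (bil-sym G G-sym v u) (bil-negʳ G v v) ⟩
      (bil G u u - bil G u v) - (bil G u v - bil G v v)
        ≡⟨ collect (bil G u u) (bil G u v) (bil G v v) ⟩
      bil G u u - + 2 * bil G u v + bil G v v ∎
      where
      collect : ∀ a b c → (a - b) - (b - c) ≡ a - + 2 * b + c
      collect = solve-∀

  norm-zero⇒≗0ᵛ : (G : Matℤ n) → (∀ (c : Vecℤ n) → ¬ (∀ i → c i ≡ 0ℤ) → 0ℤ < bil G c c) →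
                  ∀ v → bil G v v ≡ 0ℤ → v ≗ 0ᵛ
  norm-zero⇒≗0ᵛ G posdef v v·v≡0 with all? (λ i → v i ≟ 0ℤ)
  ... | yes v≗0 = v≗0
  ... | no  v≢0 = ⊥-elim (<-irrefl refl (subst (0ℤ <_) v·v≡0 (posdef v v≢0)))

RootFreeNorm : ℤ → Set
RootFreeNorm s = s ≡ 0ℤ ⊎ + 4 ≤ s

RootFreeNorm⇒≢2 : ∀ {s} → RootFreeNorm s → s ≢ + 2
RootFreeNorm⇒≢2 (inj₁ refl) ()
RootFreeNorm⇒≢2 (inj₂ (+≤+ (s≤s (s≤s (s≤s _))))) ()

even-positive-≢2⇒4≤ : ∀ {s} → 0ℤ < s → + 2 ∣ s → s ≢ + 2 → + 4 ≤ s
even-positive-≢2⇒4≤ {+ zero}  (+<+ ())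
even-positive-≢2⇒4≤ {+ suc n} _ (divides zero ())
even-positive-≢2⇒4≤ {+ suc n} _ (divides (suc zero) s≡2) s≢2 = ⊥-elim (s≢2 (cong +_ s≡2))
even-positive-≢2⇒4≤ {+ suc n} _ (divides (suc (suc q)) refl) _ = +≤+ (s≤s (s≤s (s≤s (s≤s z≤n))))

4±t-rootFree-trichotomy : ∀ t → RootFreeNorm (+ 4 - t) → RootFreeNorm (+ 4 + t) →
                          t ≡ 0ℤ ⊎ (+ 4 - t ≡ 0ℤ ⊎ + 4 + t ≡ 0ℤ)
4±t-rootFree-trichotomy t (inj₁ 4-t≡0) _            = inj₂ (inj₁ 4-t≡0)
4±t-rootFree-trichotomy t (inj₂ _)     (inj₁ 4+t≡0) = inj₂ (inj₂ 4+t≡0)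
4±t-rootFree-trichotomy t (inj₂ 4≤4-t) (inj₂ 4≤4+t) =
  inj₁ (≤-antisym (subst (_≤ 0ℤ) (4-[4-t]≡t t) (i≤j⇒i-j≤0 4≤4-t))
                  (subst (0ℤ ≤_) ([4+t]-4≡t t) (i≤j⇒0≤j-i 4≤4+t)))
  where
  4-[4-t]≡t : ∀ t → + 4 - (+ 4 - t) ≡ t
  4-[4-t]≡t = solve-∀
  [4+t]-4≡t : ∀ t → (+ 4 + t) - + 4 ≡ t
  [4+t]-4≡t = solve-∀

double-injective : ∀ {b s r : ℤ} → b ≡ + 2 * s → b ≡ + 2 * r → s ≡ r
double-injective {s = s} {r} b≡2s b≡2r = *-cancelˡ-≡ (+ 2) s r (trans (sym b≡2s) b≡2r)

rootFree-norm : ∀ {n} (A : Matℤ n) → (∀ (c : Vecℤ n) → ¬ (∀ i → c i ≡ 0ℤ) → 0ℤ < bil A c c) →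
                (∀ (c : Vecℤ n) → + 2 ∣ bil A c c) → (∀ (c : Vecℤ n) → bil A c c ≢ + 2) →
                ∀ (c : Vecℤ n) → RootFreeNorm (bil A c c)
rootFree-norm A posdef even noRoots c with all? (λ i → c i ≟ 0ℤ)
... | yes c≗0 = inj₁ (trans (bil-cong A c≗0 (λ _ → refl)) (bil-zeroˡ A c))
... | no  c≢0 = inj₂ (even-positive-≢2⇒4≤ (posdef c c≢0) (even c) (noRoots c))

leechGram-rootFreeNorm : ∀ {A} → IsLeechGram A → ∀ (c : Vecℤ 24) → RootFreeNorm (bil A c c)
leechGram-rootFreeNorm {A} LG = rootFree-norm A posdef even noRoots
  where open IsLeechGram LG

-- Vectors are passed explicitly from here on: inferring them from a type mentioning bil G
-- at size 24 makes the unifier unfold the sums.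
isoLeech-norm : (G : Matℤ 24) (P : Subset) → IsoLeech G P → ∀ (v : Vecℤ 24) → P v →
                ∃ λ s → bil G v v ≡ + 2 * s × RootFreeNorm s
isoLeech-norm G P (B , A , LG , gram , span) v v∈P =
  let c , v≗cB = Equivalence.to (span v) v∈P
  in bil A c c , norm c v≗cB , leechGram-rootFreeNorm LG c
  where
  norm : ∀ (c : Vecℤ 24) → v ≗ c ·ᵛ B → bil G v v ≡ + 2 * bil A c c
  norm c v≗cB = begin
    bil G v v                        ≡⟨ bil-cong G v≗cB v≗cB ⟩
    bil G (c ·ᵛ B) (c ·ᵛ B)          ≡⟨ bil-·ᵛ G B c c ⟩
    bil (Gram G B) c c               ≡⟨ bil-congᴹ gram c c ⟩
    bil (λ i j → + 2 * A i j) c c    ≡⟨ bil-*ᴹ (+ 2) A c c ⟩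
    + 2 * bil A c c                  ∎

isoLeech-noRoot : (G : Matℤ 24) (P : Subset) → IsoLeech G P → ∀ (v : Vecℤ 24) → P v → ¬ ΥNorm2 G v
isoLeech-noRoot G P iso v v∈P v·v≡4 =
  let _ , v·v≡2s , gap = isoLeech-norm G P iso v v∈P
  in RootFreeNorm⇒≢2 gap (double-injective v·v≡2s v·v≡4)

root-pair-trichotomy :
  (G : Matℤ 24) → (∀ i j → G i j ≡ G j i) → (P : Subset) → IsoLeech G P →
  ∀ (a b d e : Vecℤ 24) → ΥNorm2 G a → ΥNorm2 G b →
  P d → d ≗ a +ᵛ (-ᵛ b) → P e → e ≗ a +ᵛ b →
  bil G a b ≡ 0ℤ ⊎ (bil G d d ≡ 0ℤ ⊎ bil G e e ≡ 0ℤ)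
root-pair-trichotomy G G-sym P iso a b d e a·a≡4 b·b≡4 d∈P d≗a-b e∈P e≗a+b =
  let s₁ , d·d≡2s₁ , gap₁ = isoLeech-norm G P iso d d∈P
      s₂ , e·e≡2s₂ , gap₂ = isoLeech-norm G P iso e e∈P
      gap₋ = subst RootFreeNorm (double-injective d·d≡2s₁ d·d≡2[4-t]) gap₁
      gap₊ = subst RootFreeNorm (double-injective e·e≡2s₂ e·e≡2[4+t]) gap₂
  in Sum.map₂ (Sum.map (λ 4-t≡0 → trans d·d≡2[4-t] (cong (λ s → + 2 * s) 4-t≡0))
                       (λ 4+t≡0 → trans e·e≡2[4+t] (cong (λ s → + 2 * s) 4+t≡0)))
              (4±t-rootFree-trichotomy t gap₋ gap₊)
  where
  t : ℤ
  t = bil G a b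
  d·d≡2[4-t] : bil G d d ≡ + 2 * (+ 4 - t)
  d·d≡2[4-t] = begin
    bil G d d                            ≡⟨ bil-cong G d≗a-b d≗a-b ⟩
    bil G (a +ᵛ (-ᵛ b)) (a +ᵛ (-ᵛ b))    ≡⟨ bil-norm-difference G G-sym a b ⟩
    bil G a a - + 2 * t + bil G b b      ≡⟨ cong₂ (λ p q → p - + 2 * t + q) a·a≡4 b·b≡4 ⟩
    + 4 - + 2 * t + + 4                  ≡⟨ factor t ⟩
    + 2 * (+ 4 - t)                      ∎
    where
    factor : ∀ t → + 4 - + 2 * t + + 4 ≡ + 2 * (+ 4 - t)
    factor = solve-∀
  e·e≡2[4+t] : bil G e e ≡ + 2 * (+ 4 + t)
  e·e≡2[4+t] = begin
    bil G e e                            ≡⟨ bil-cong G e≗a+b e≗a+b ⟩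
    bil G (a +ᵛ b) (a +ᵛ b)              ≡⟨ bil-norm-sum G G-sym a b ⟩
    bil G a a + + 2 * t + bil G b b      ≡⟨ cong₂ (λ p q → p + + 2 * t + q) a·a≡4 b·b≡4 ⟩
    + 4 + + 2 * t + + 4                  ≡⟨ factor t ⟩
    + 2 * (+ 4 + t)                      ∎
    where
    factor : ∀ t → + 4 + + 2 * t + + 4 ≡ + 2 * (+ 4 + t)
    factor = solve-∀

doubles∈M∩N : ∀ {G M N} → Polarization G M N → ∀ (v u : Vecℤ 24) → v ≗ 2ᵛ u → M v × N v
doubles∈M∩N pol v u v≗2u = Equivalence.from (Polarization.inter pol v) (u , v≗2u)

z≡2[u-x] : ∀ x y z u → x - y ≡ 0ℤ → (x + y) + z ≡ + 2 * u → z ≡ + 2 * (u - x)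
z≡2[u-x] x y z u x-y≡0 x+y+z≡2u = begin
  z                                   ≡⟨ rearrange x y z ⟩
  ((x + y) + z) - + 2 * x + (x - y)   ≡⟨ cong₂ (λ p q → p - + 2 * x + q) x+y+z≡2u x-y≡0 ⟩
  + 2 * u - + 2 * x + 0ℤ              ≡⟨ factor u x ⟩
  + 2 * (u - x)                       ∎
  where
  rearrange : ∀ x y z → z ≡ ((x + y) + z) - + 2 * x + (x - y)
  rearrange = solve-∀
  factor : ∀ u x → + 2 * u - + 2 * x + 0ℤ ≡ + 2 * (u - x)
  factor = solve-∀

z≡2[u+w] : ∀ x y z w u → (x + y) + + 2 * w ≡ 0ℤ → (x + y) + z ≡ + 2 * u → z ≡ + 2 * (u + w)
z≡2[u+w] x y z w u x+y+2w≡0 x+y+z≡2u = begin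
  z                                               ≡⟨ rearrange x y z w ⟩
  ((x + y) + z) - ((x + y) + + 2 * w) + + 2 * w   ≡⟨ cong₂ (λ p q → p - q + + 2 * w) x+y+z≡2u x+y+2w≡0 ⟩
  + 2 * u - 0ℤ + + 2 * w                          ≡⟨ factor u w ⟩
  + 2 * (u + w)                                   ∎
  where
  rearrange : ∀ x y z w → z ≡ ((x + y) + z) - ((x + y) + + 2 * w) + + 2 * w
  rearrange = solve-∀
  factor : ∀ u w → + 2 * u - 0ℤ + + 2 * w ≡ + 2 * (u + w)
  factor = solve-∀

offender-pair-orthogonal :
  (G : Matℤ 24) → IsLeechGram G → (M N : Subset) → Polarization G M N → IsoLeech G M → IsoLeech G N →
  (w : Vecℤ 24) → N w → (x y z u : Vecℤ 24) → M x → M y → M z → (x +ᵛ y) +ᵛ z ≗ 2ᵛ u →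
  ΥNorm2 G (x +ᵛ w) → ΥNorm2 G (y +ᵛ w) → ΥNorm2 G (z +ᵛ w) →
  bil G (x +ᵛ w) (y +ᵛ w) ≡ 0ℤ
offender-pair-orthogonal G LG M N pol isoM isoN w w∈N x y z u
                         x∈M y∈M z∈M x+y+z≗2u x+w-root y+w-root z+w-root =
  orthogonal-unless-z∈N
    (root-pair-trichotomy G symmetric M isoM (x +ᵛ w) (y +ᵛ w) x-y x+y+2w
       x+w-root y+w-root
       x-y∈M (λ k → x-y≡[x+w]-[y+w] (x k) (y k) (w k))
       x+y+2w∈M (λ k → x+y+2w≡[x+w]+[y+w] (x k) (y k) (w k)))
  where
  open IsLeechGram LG
  open IsSublattice (Polarization.subM pol) using (closed+; closed-)

  x-y x+y+2w : Vecℤ 24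
  x-y    = x +ᵛ (-ᵛ y)
  x+y+2w = (x +ᵛ y) +ᵛ (2ᵛ w)

  x-y∈M : M x-y
  x-y∈M = closed+ {x} { -ᵛ y} x∈M (closed- {y} y∈M)
  x+y+2w∈M : M x+y+2w
  x+y+2w∈M = closed+ {x +ᵛ y} {2ᵛ w} (closed+ {x} {y} x∈M y∈M)
                     (proj₁ (doubles∈M∩N pol (2ᵛ w) w (λ _ → refl)))

  x-y≡[x+w]-[y+w] : ∀ x y w → x - y ≡ (x + w) - (y + w)
  x-y≡[x+w]-[y+w] = solve-∀
  x+y+2w≡[x+w]+[y+w] : ∀ x y w → (x + y) + + 2 * w ≡ (x + w) + (y + w)
  x+y+2w≡[x+w]+[y+w] = solve-∀

  z∉N : ¬ N z
  z∉N z∈N = isoLeech-noRoot G N isoN (z +ᵛ w)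
              (IsSublattice.closed+ (Polarization.subN pol) {z} {w} z∈N w∈N) z+w-root

  orthogonal-unless-z∈N :
    bil G (x +ᵛ w) (y +ᵛ w) ≡ 0ℤ ⊎ (bil G x-y x-y ≡ 0ℤ ⊎ bil G x+y+2w x+y+2w ≡ 0ℤ) →
    bil G (x +ᵛ w) (y +ᵛ w) ≡ 0ℤ
  orthogonal-unless-z∈N (inj₁ orthogonal) = orthogonal
  orthogonal-unless-z∈N (inj₂ (inj₁ x-y-null)) =
    let x-y≗0 = norm-zero⇒≗0ᵛ G posdef x-y x-y-null
    in ⊥-elim (z∉N (proj₂ (doubles∈M∩N pol z (λ k → u k - x k)
                 λ k → z≡2[u-x] (x k) (y k) (z k) (u k) (x-y≗0 k) (x+y+z≗2u k))))
  orthogonal-unless-z∈N (inj₂ (inj₂ x+y+2w-null)) =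
    let x+y+2w≗0 = norm-zero⇒≗0ᵛ G posdef x+y+2w x+y+2w-null
    in ⊥-elim (z∉N (proj₂ (doubles∈M∩N pol z (λ k → u k + w k)
                 λ k → z≡2[u+w] (x k) (y k) (z k) (w k) (u k) (x+y+2w≗0 k) (x+y+z≗2u k))))

lemma4p6 : (G : Matℤ 24) → IsLeechGram G → (M N : Subset) → Polarization G M N
    → IsoLeech G M → IsoLeech G N → (w x y z : Vecℤ 24) → Offender G M N w x y z
    → (bil G (x +ᵛ w) (y +ᵛ w) ≡ 0ℤ) × (bil G (x +ᵛ w) (z +ᵛ w) ≡ 0ℤ)
      × (bil G (y +ᵛ w) (z +ᵛ w) ≡ 0ℤ)
lemma4p6 G LG M N pol isoM isoN w x y z off =
  let u , x+y+z≗2u = Equivalence.to (Polarization.inter pol ((x +ᵛ y) +ᵛ z)) admissible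
  in orthogonal x y z u x∈M y∈M z∈M x+y+z≗2u normxw normyw normzw
   , orthogonal x z y u x∈M z∈M y∈M (λ k → trans (xy∙z≈xz∙y (x k) (z k) (y k)) (x+y+z≗2u k))
                normxw normzw normyw
   , orthogonal y z x u y∈M z∈M x∈M (λ k → trans (xy∙z≈zx∙y (y k) (z k) (x k)) (x+y+z≗2u k))
                normyw normzw normxw
  where
  open Offender off
  orthogonal : (a b c u : Vecℤ 24) → M a → M b → M c → (a +ᵛ b) +ᵛ c ≗ 2ᵛ u →
               ΥNorm2 G (a +ᵛ w) → ΥNorm2 G (b +ᵛ w) → ΥNorm2 G (c +ᵛ w) →
               bil G (a +ᵛ w) (b +ᵛ w) ≡ 0ℤ
  orthogonal = offender-pair-orthogonal G LG M N pol isoM isoN w w∈N
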